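{- Let $h\geq r$ be positive integers and let $0<\beta<1$ be a real. There exists a positive real $\alpha$ depending on $h,r$ and $\beta$ such that the following is true. Let $G$ be any graph on $n$ vertices and let $p=p_r(G)$. For each $0\leq i\leq h$ and $1\leq j\leq h$, let $\mathcal{A}_{i,j}$ denote the set of $i$-good sequences of length $j$ relative to $(\alpha,\beta,h,r)$ in $V(G)$, and let $\mathcal{B}_{i,j}=V(G)^j\setminus\mathcal{A}_{i,j}$, where $V(G)^j$ is the set of all sequences of length $j$ in $V(G)$. Then for each $0\leq i\leq h$, $1\leq j\leq h$ and $1\leq\ell\leq j$, \[ \sum_{S\in\mathcal{B}_{i,j}}|N(S)|^\ell\leq\beta\,n^{j+\ell}p^{j\ell}. \]
   Context: All graphs are finite simple graphs. For a positive integer $r$, $p_r(G)=t_{K_{1,r}}(G)^{1/r}$ where $t_{K_{1,r}}(G)=\frac{1}{|G|^{r+1}}\sum_{v\in V(G)}d(v)^r$. A sequence in a set $W$ is a finite sequence of elements of $W$ (repetitions allowed); its length is its number of terms. For a sequence $S$ in $V(G)$, $N(S)$ is the set of vertices adjacent to every vertex of $S$; a sequence in $N(S)$ is a sequence all of whose terms lie in $N(S)$. Goodness relative to $(\alpha,\beta,h,r)$: for an $n$-vertex graph $G$ let $p=p_r(G)$. A sequence $T$ in $V(G)$ is $0$-good if $|N(T)|\geq \alpha p^{|T|}n$. For $1\leq i\leq h$, a sequence $S$ in $V(G)$ of length at most $h$ is $i$-good if $S$ is $0$-good and, for each $|S|\leq k\leq h$, the number of $(i-1)$-good sequences of length $k$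 in $N(S)$ is at least $(1-\beta)|N(S)|^k$.
   Formalization: The parameter β ranges over the rationals in (0,1) rather than the reals. -}

module Defs where

open import Data.Bool using (Bool; true; false; if_then_else_; _∧_; not)
open import Data.Nat as ℕ using (ℕ; zero; suc)
open import Data.Fin using (Fin)
open import Data.List using (List; []; _∷_; length; map; allFin; concatMap)
open import Data.Nat.ListAction using (sum)
open import Data.Integer using (+_)
open import Data.Rational using (ℚ; _≤_; _*_; _-_; _/_; 0ℚ; 1ℚ)
open import Data.Rational.Properties using (_≤?_)
open import Data.Nat.Properties using (m^n≢0)
open import Relation.Nullary.Decidable using (does)
open import Relation.Binary.PropositionalEquality using (_≡_)

record Graph (n : ℕ) : Set where
  field
    adj   : Fin n → Fin n → Bool
    sym   : ∀ u v → adj u v ≡ adj v u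
    irrefl : ∀ v → adj v v ≡ false
open Graph public

filter : {A : Set} → (A → Bool) → List A → List A
filter p [] = []
filter p (x ∷ xs) = if p x then x ∷ filter p xs else filter p xs

all : {A : Set} → (A → Bool) → List A → Bool
all p [] = true
all p (x ∷ xs) = p x ∧ all p xs

ℕ→ℚ : ℕ → ℚ
ℕ→ℚ m = (+ m) / 1

_^ℚ_ : ℚ → ℕ → ℚ
x ^ℚ zero = 1ℚ
x ^ℚ suc k = x * (x ^ℚ k)

ratio : ℕ → ℕ → ℕ → ℚ
ratio D zero r = 0ℚ
ratio D (suc m) r = (+ D) / (suc m ℕ.^ suc r)
  where instance _ = m^n≢0 (suc m) (suc r)

module _ {n : ℕ} (G : Graph n) where

  deg : Fin n → ℕ
  deg v = length (filter (λ u → adj G v u) (allFin n))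

  tStar : ℕ → ℚ
  tStar r = ratio (sum (map (λ v → deg v ℕ.^ r) (allFin n))) n r

  -- p = p_r(G) = tStar r ^ (1/r) is in general irrational.  All comparisons
  -- with powers of p are between nonnegative quantities, so we state them by
  -- raising both sides to the r-th power (p^r = tStar r):
  --   x ≤ c · p^k   ⟺   x^r ≤ c^r · t^k       (x, c ≥ 0)
  --   x ≥ c · p^k   ⟺   c^r · t^k ≤ x^r       (x, c ≥ 0)
  ≤c·p^ : (r : ℕ) → ℚ → ℚ → ℕ → Set
  ≤c·p^ r x c k = x ^ℚ r ≤ (c ^ℚ r) * (tStar r ^ℚ k)

  ≥c·p^? : (r : ℕ) → ℚ → ℚ → ℕ → Bool
  ≥c·p^? r x c k = does (((c ^ℚ r) * (tStar r ^ℚ k)) ≤? (x ^ℚ r))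

  inN : List (Fin n) → Fin n → Bool
  inN S v = all (λ s → adj G s v) S

  cardN : List (Fin n) → ℕ
  cardN S = length (filter (inN S) (allFin n))

  seqs : ℕ → List (List (Fin n))
  seqs zero    = [] ∷ []
  seqs (suc k) = concatMap (λ v → map (v ∷_) (seqs k)) (allFin n)

  module Goodness (α β : ℚ) (h r : ℕ) where

    good0 : List (Fin n) → Bool
    good0 T = ≥c·p^? r (ℕ→ℚ (cardN T)) (α * ℕ→ℚ n) (length T)

    range : ℕ → List ℕ
    range zero = zero ∷ []
    range (suc m) = suc m ∷ range m

    ks : List (Fin n) → List ℕ
    ks S = filter (λ k → does (length S ℕ.≤? k)) (range h)

    good : ℕ → List (Fin n) → Bool
    countGood : ℕ → List (Fin n) → ℕ → ℕ
    good zero T = good0 T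
    good (suc i) S =
      does (length S ℕ.≤? h) ∧ good0 S ∧
      all (λ k → does (((1ℚ - β) * (ℕ→ℚ (cardN S) ^ℚ k)) ≤? ℕ→ℚ (countGood i S k)))
          (ks S)
    countGood i S k =
      length (filter (λ T → all (inN S) T ∧ good i T) (seqs k))

    badSum : ℕ → ℕ → ℕ → ℕ
    badSum i j ℓ =
      sum (map (λ S → cardN S ℕ.^ ℓ) (filter (λ S → not (good i S)) (seqs j)))

module Submission where

-- A sequence S of length j that is not (i+1)-good either is not 0-good, or has
-- E·|N(S)| < n·p^j, or has E·|N(S)| ≥ n·p^j while, for some j ≤ k ≤ h, more than
-- β·|N(S)|^k of the length-k sequences in N(S) are not i-good.  In the first two cases
-- E·|N(S)|^ℓ ≤ (n·p^j)^ℓ, and there are at most n^j such S.  In the third, double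
-- counting the pairs (S, T) with T in N(S) bounds Σ_S |N(S)|^k by B·Σ_{T ∈ B_{i,k}} |N(T)|^j,
-- where B is the denominator of β (so β·B ≥ 1), and |N(S)| ≥ n·p^j / E trades the
-- exponent k for ℓ.  Hence a bound C'·Σ_{S ∈ B_{i,j}} |N(S)|^ℓ ≤ n^(j+ℓ)·p^(jℓ) for all
-- j, ℓ with C' = B·((h+3)·C)^(h+1) gives the same bound for level i + 1 with C: take
-- E = (h+3)·C, so that each of the h + 3 cases contributes n^(j+ℓ)·p^(jℓ)/E.  Level 0 holds
-- for every C ≤ 1/α by the first case, so α comes from the h-fold iterate of
-- C ↦ B·((h+3)·C)^(h+1) at B; in the end C = B, and β·B ≥ 1 gives the factor β.
-- As p = t^(1/r) is irrational in general, a ≤ c·p^e is handled as a^r ≤ c^r·t^e, and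
-- such bounds are added using the mediant inequality.

open import Defs
open import Data.Nat using (ℕ; _≤_; _+_; _*_; _^_)
open import Data.Product using (Σ; _×_)
open import Data.Rational using (ℚ; _<_; 0ℚ; 1ℚ) renaming (_*_ to _*ℚ_)

open import Algebra.Bundles using (CommutativeMonoid)
import Algebra.Properties.CommutativeSemigroup as CommSemigroupProperties
open import Data.Bool using (Bool; true; false; if_then_else_; _∧_; not)
import Data.Bool.Properties as Boolₚ
open import Data.Empty using (⊥-elim)
open import Data.Fin using (Fin)
import Data.Integer as ℤ
import Data.Integer.Properties as ℤₚ
open import Data.List using (List; []; _∷_; _++_; length; map; concatMap; allFin)
import Data.List.Properties as Listₚ
open import Data.List.Membership.Propositional using (_∈_)
open import Data.List.Membership.Propositional.Properties using (∈-allFin)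
open import Data.List.Relation.Unary.All as All using (All; []; _∷_)
import Data.List.Relation.Unary.All.Properties as Allₚ
open import Data.List.Relation.Unary.Any as Any using (Any; here; there)
import Data.List.Relation.Unary.Any.Properties as Anyₚ
open import Data.Nat as ℕ using (zero; suc; z≤n; s≤s; _∸_; _≤?_)
import Data.Nat.Properties as ℕₚ
open import Data.Nat.Coprimality using (1-coprimeTo) renaming (sym to coprime-sym)
open import Data.Nat.ListAction using (sum)
open import Data.Product using (_,_; proj₁; proj₂)
open import Data.Sum using (_⊎_; inj₁; inj₂; [_,_]′)
import Data.Rational as ℚ
open import Data.Rational using (Positive) renaming (_≤_ to _≤ℚ_; _+_ to _+ℚ_; _-_ to _-ℚ_)
import Data.Rational.Properties as ℚₚ
open import Data.Rational.Solver using (module +-*-Solver)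
open +-*-Solver using (solve; _:+_; _:*_; :-_; _:-_; _:=_; con)
import Data.Rational.Unnormalised as ℚᵘ
import Data.Rational.Unnormalised.Properties as ℚᵘₚ
open import Relation.Binary using (tri<; tri≈; tri>)
open import Relation.Binary.PropositionalEquality using (_≡_; refl; trans; cong; cong₂; subst; subst₂; module ≡-Reasoning)
import Relation.Binary.PropositionalEquality as ≡
open import Relation.Nullary using (¬_; Dec; yes; no)
open import Relation.Nullary.Decidable using (does; dec-true; dec-false)

open CommSemigroupProperties (CommutativeMonoid.commutativeSemigroup ℚₚ.*-1-commutativeMonoid)
  renaming (interchange to *ℚ-interchange; xy∙z≈xz∙y to *ℚ-right-comm;
            xy∙z≈y∙xz to *ℚ-swap-left; x∙yz≈xz∙y to *ℚ-swap-right)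
open CommSemigroupProperties ℕₚ.+-commutativeSemigroup using () renaming (interchange to +-interchange)
open CommSemigroupProperties ℕₚ.*-commutativeSemigroup using () renaming (x∙yz≈y∙xz to x*yz≡y*xz)
open CommSemigroupProperties (CommutativeMonoid.commutativeSemigroup Boolₚ.∧-commutativeMonoid)
  using () renaming (interchange to ∧-interchange)

^-distribʳ-* : ∀ a b k → (a * b) ^ k ≡ a ^ k * b ^ k
^-distribʳ-* a b zero    = refl
^-distribʳ-* a b (suc k) =
  trans (cong (a * b *_) (^-distribʳ-* a b k)) (ℕₚ.[m*n]*[o*p]≡[m*o]*[n*p] a b (a ^ k) (b ^ k))

^-comm : ∀ a k m → (a ^ k) ^ m ≡ (a ^ m) ^ k
^-comm a k m = trans (ℕₚ.^-*-assoc a k m) (trans (cong (a ^_) (ℕₚ.*-comm k m)) (≡.sym (ℕₚ.^-*-assoc a m k)))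

≤-^ : ∀ a ℓ → 1 ≤ ℓ → a ≤ a ^ ℓ
≤-^ zero    (suc ℓ) _ = z≤n
≤-^ (suc a) (suc ℓ) _ = ℕₚ.m≤m*n (suc a) (suc a ^ ℓ) {{ℕₚ.m^n≢0 (suc a) ℓ}}

^-mediant-≤ : ∀ r {a b c d} → b * c ≤ a * d → (a + b) ^ r * c ^ r ≤ a ^ r * (c + d) ^ r
^-mediant-≤ r {a} {b} {c} {d} bc≤ad =
  subst₂ _≤_ (^-distribʳ-* (a + b) c r) (^-distribʳ-* a (c + d) r) (ℕₚ.^-monoˡ-≤ r mediant)
  where
  mediant : (a + b) * c ≤ a * (c + d)
  mediant = subst₂ _≤_ (≡.sym (ℕₚ.*-distribʳ-+ c a b)) (≡.sym (ℕₚ.*-distribˡ-+ a c d))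
                       (ℕₚ.+-monoʳ-≤ (a * c) bc≤ad)

^-moment : ∀ E x ℓ d r → ((x ^ ℓ) ^ r) * ((E * x) ^ r) ^ d ≡ (E ^ d * x ^ (ℓ + d)) ^ r
^-moment E x ℓ d r = begin
  (x ^ ℓ) ^ r * ((E * x) ^ r) ^ d      ≡⟨ cong ((x ^ ℓ) ^ r *_) (^-comm (E * x) r d) ⟩
  (x ^ ℓ) ^ r * ((E * x) ^ d) ^ r      ≡⟨ ^-distribʳ-* (x ^ ℓ) ((E * x) ^ d) r ⟨
  (x ^ ℓ * (E * x) ^ d) ^ r            ≡⟨ cong (λ y → (x ^ ℓ * y) ^ r) (^-distribʳ-* E x d) ⟩
  (x ^ ℓ * (E ^ d * x ^ d)) ^ r        ≡⟨ cong (_^ r) (x*yz≡y*xz (x ^ ℓ) (E ^ d) (x ^ d)) ⟩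
  (E ^ d * (x ^ ℓ * x ^ d)) ^ r        ≡⟨ cong (λ y → (E ^ d * y) ^ r) (ℕₚ.^-distribˡ-+-* x ℓ d) ⟨
  (E ^ d * x ^ (ℓ + d)) ^ r            ∎
  where open ≡-Reasoning

ℕ→ℚ≡mkℚ : ∀ m → ℕ→ℚ m ≡ ℚ.mkℚ (ℤ.+ m) 0 (coprime-sym (1-coprimeTo m))
ℕ→ℚ≡mkℚ m = ℚₚ.normalize-coprime (coprime-sym (1-coprimeTo m))

ℕ→ℚ-+ : ∀ a b → ℕ→ℚ (a + b) ≡ ℕ→ℚ a +ℚ ℕ→ℚ b
ℕ→ℚ-+ a b = ℚₚ.toℚᵘ-injective (ℚᵘₚ.≃-trans ≃-sum (ℚᵘₚ.≃-sym (ℚₚ.toℚᵘ-homo-+ (ℕ→ℚ a) (ℕ→ℚ b))))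
  where
  ≃-sum : ℚ.toℚᵘ (ℕ→ℚ (a + b)) ℚᵘ.≃ (ℚ.toℚᵘ (ℕ→ℚ a) ℚᵘ.+ ℚ.toℚᵘ (ℕ→ℚ b))
  ≃-sum rewrite ℕ→ℚ≡mkℚ a | ℕ→ℚ≡mkℚ b | ℕ→ℚ≡mkℚ (a + b)
              | ℤₚ.+◃n≡+n (a * 1) | ℤₚ.+◃n≡+n (b * 1) | ℕₚ.*-identityʳ a | ℕₚ.*-identityʳ b = ℚᵘ.*≡* refl

ℕ→ℚ-* : ∀ a b → ℕ→ℚ (a * b) ≡ ℕ→ℚ a *ℚ ℕ→ℚ b
ℕ→ℚ-* a b = ℚₚ.toℚᵘ-injective (ℚᵘₚ.≃-trans ≃-product (ℚᵘₚ.≃-sym (ℚₚ.toℚᵘ-homo-* (ℕ→ℚ a) (ℕ→ℚ b))))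
  where
  ≃-product : ℚ.toℚᵘ (ℕ→ℚ (a * b)) ℚᵘ.≃ (ℚ.toℚᵘ (ℕ→ℚ a) ℚᵘ.* ℚ.toℚᵘ (ℕ→ℚ b))
  ≃-product rewrite ℕ→ℚ≡mkℚ a | ℕ→ℚ≡mkℚ b | ℕ→ℚ≡mkℚ (a * b) | ℤₚ.+◃n≡+n (a * b) = ℚᵘ.*≡* refl

ℕ→ℚ-^ : ∀ a k → ℕ→ℚ (a ^ k) ≡ ℕ→ℚ a ^ℚ k
ℕ→ℚ-^ a zero    = refl
ℕ→ℚ-^ a (suc k) = trans (ℕ→ℚ-* a (a ^ k)) (cong (ℕ→ℚ a *ℚ_) (ℕ→ℚ-^ a k))

ℕ→ℚ-*-^ : ∀ a b k → ℕ→ℚ ((a * b) ^ k) ≡ ℕ→ℚ (a ^ k) *ℚ ℕ→ℚ (b ^ k)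
ℕ→ℚ-*-^ a b k = trans (cong ℕ→ℚ (^-distribʳ-* a b k)) (ℕ→ℚ-* (a ^ k) (b ^ k))

ℕ→ℚ-mono-≤ : ∀ {a b} → a ≤ b → ℕ→ℚ a ≤ℚ ℕ→ℚ b
ℕ→ℚ-mono-≤ {a} {b} a≤b rewrite ℕ→ℚ≡mkℚ a | ℕ→ℚ≡mkℚ b =
  ℚ.*≤* (ℤₚ.*-monoʳ-≤-nonNeg (ℤ.+ 1) (ℤ.+≤+ a≤b))

ℕ→ℚ-cancel-≤ : ∀ {a b} → ℕ→ℚ a ≤ℚ ℕ→ℚ b → a ≤ b
ℕ→ℚ-cancel-≤ {a} {b} le rewrite ℕ→ℚ≡mkℚ a | ℕ→ℚ≡mkℚ b with le
... | ℚ.*≤* p rewrite ℤₚ.*-identityʳ (ℤ.+ a) | ℤₚ.*-identityʳ (ℤ.+ b) = ℤₚ.drop‿+≤+ p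

ℕ→ℚ-nonNeg : ∀ a → 0ℚ ≤ℚ ℕ→ℚ a
ℕ→ℚ-nonNeg a = ℕ→ℚ-mono-≤ {0} {a} z≤n

ℕ→ℚ-pos : ∀ {a} → 1 ≤ a → 0ℚ < ℕ→ℚ a
ℕ→ℚ-pos 1≤a = ℚₚ.<-≤-trans (ℚ.*<* (ℤ.+<+ (s≤s z≤n))) (ℕ→ℚ-mono-≤ 1≤a)

*ℚ-mono-≤ : ∀ {a b c d} → 0ℚ ≤ℚ a → 0ℚ ≤ℚ c → a ≤ℚ b → c ≤ℚ d → a *ℚ c ≤ℚ b *ℚ d
*ℚ-mono-≤ {a} {b} {c} {d} 0≤a 0≤c a≤b c≤d =
  ℚₚ.≤-trans (ℚₚ.*-monoʳ-≤-nonNeg c {{ℚ.nonNegative 0≤c}} a≤b)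
             (ℚₚ.*-monoˡ-≤-nonNeg b {{ℚ.nonNegative (ℚₚ.≤-trans 0≤a a≤b)}} c≤d)

*ℚ-monoˡ-≤ : ∀ c {a b} → 0ℚ ≤ℚ c → a ≤ℚ b → c *ℚ a ≤ℚ c *ℚ b
*ℚ-monoˡ-≤ c 0≤c = ℚₚ.*-monoˡ-≤-nonNeg c {{ℚ.nonNegative 0≤c}}

*ℚ-monoʳ-≤ : ∀ c {a b} → 0ℚ ≤ℚ c → a ≤ℚ b → a *ℚ c ≤ℚ b *ℚ c
*ℚ-monoʳ-≤ c 0≤c = ℚₚ.*-monoʳ-≤-nonNeg c {{ℚ.nonNegative 0≤c}}

*ℚ-nonNeg : ∀ {a b} → 0ℚ ≤ℚ a → 0ℚ ≤ℚ b → 0ℚ ≤ℚ a *ℚ b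
*ℚ-nonNeg {a} {b} 0≤a 0≤b =
  subst (_≤ℚ a *ℚ b) (ℚₚ.*-zeroˡ b) (*ℚ-monoʳ-≤ b 0≤b 0≤a)

*ℚ-pos : ∀ {a b} → 0ℚ < a → 0ℚ < b → 0ℚ < a *ℚ b
*ℚ-pos {a} {b} 0<a 0<b =
  subst (_< a *ℚ b) (ℚₚ.*-zeroˡ b) (ℚₚ.*-monoˡ-<-pos b {{ℚ.positive 0<b}} 0<a)

+ℚ-cancelˡ-< : ∀ a {b c} → a +ℚ b < a +ℚ c → b < c
+ℚ-cancelˡ-< a {b} {c} a+b<a+c = subst₂ _<_ (-a+[a+x]≡x b) (-a+[a+x]≡x c) (ℚₚ.+-monoʳ-< (ℚ.- a) a+b<a+c)
  where
  -a+[a+x]≡x : ∀ x → ℚ.- a +ℚ (a +ℚ x) ≡ x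
  -a+[a+x]≡x = solve 2 (λ a x → (:- a) :+ (a :+ x) := x) refl a

[1-β]x+βx≡x : ∀ β x → (1ℚ -ℚ β) *ℚ x +ℚ β *ℚ x ≡ x
[1-β]x+βx≡x = solve 2 (λ β x → (con 1ℚ :- β) :* x :+ β :* x := x) refl

^ℚ-nonNeg : ∀ {x} k → 0ℚ ≤ℚ x → 0ℚ ≤ℚ x ^ℚ k
^ℚ-nonNeg zero    0≤x = ℚₚ.nonNegative⁻¹ 1ℚ
^ℚ-nonNeg (suc k) 0≤x = *ℚ-nonNeg 0≤x (^ℚ-nonNeg k 0≤x)

^ℚ-pos : ∀ {x} k → 0ℚ < x → 0ℚ < x ^ℚ k
^ℚ-pos zero    0<x = ℚₚ.positive⁻¹ 1ℚ
^ℚ-pos (suc k) 0<x = *ℚ-pos 0<x (^ℚ-pos k 0<x)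

^ℚ-monoˡ-≤ : ∀ {x y} k → 0ℚ ≤ℚ x → x ≤ℚ y → x ^ℚ k ≤ℚ y ^ℚ k
^ℚ-monoˡ-≤ zero    0≤x x≤y = ℚₚ.≤-refl
^ℚ-monoˡ-≤ (suc k) 0≤x x≤y = *ℚ-mono-≤ 0≤x (^ℚ-nonNeg k 0≤x) x≤y (^ℚ-monoˡ-≤ k 0≤x x≤y)

^ℚ-distribʳ-* : ∀ x y k → (x *ℚ y) ^ℚ k ≡ (x ^ℚ k) *ℚ (y ^ℚ k)
^ℚ-distribʳ-* x y zero    = refl
^ℚ-distribʳ-* x y (suc k) =
  trans (cong ((x *ℚ y) *ℚ_) (^ℚ-distribʳ-* x y k)) (*ℚ-interchange x y (x ^ℚ k) (y ^ℚ k))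

^ℚ-distribˡ-+-* : ∀ x a b → x ^ℚ (a + b) ≡ (x ^ℚ a) *ℚ (x ^ℚ b)
^ℚ-distribˡ-+-* x zero    b = ≡.sym (ℚₚ.*-identityˡ (x ^ℚ b))
^ℚ-distribˡ-+-* x (suc a) b =
  trans (cong (x *ℚ_) (^ℚ-distribˡ-+-* x a b)) (≡.sym (ℚₚ.*-assoc x (x ^ℚ a) (x ^ℚ b)))

^ℚ-*-assoc : ∀ x a b → (x ^ℚ a) ^ℚ b ≡ x ^ℚ (a * b)
^ℚ-*-assoc x a zero    rewrite ℕₚ.*-zeroʳ a = refl
^ℚ-*-assoc x a (suc b) rewrite ℕₚ.*-suc a b =
  trans (cong ((x ^ℚ a) *ℚ_) (^ℚ-*-assoc x a b)) (≡.sym (^ℚ-distribˡ-+-* x a (a * b)))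

1^ℚ : ∀ k → 1ℚ ^ℚ k ≡ 1ℚ
1^ℚ zero    = refl
1^ℚ (suc k) = trans (ℚₚ.*-identityˡ (1ℚ ^ℚ k)) (1^ℚ k)

1≤β*denominator : ∀ {β} → 0ℚ < β → 1ℚ ≤ℚ β *ℚ ℕ→ℚ (ℚ.denominatorℕ β)
1≤β*denominator {β@(ℚ.mkℚ ℤ.+[1+ p ] d _)} _ =
  ℚₚ.toℚᵘ-cancel-≤ (ℚᵘₚ.≤-respʳ-≃ (ℚᵘₚ.≃-sym (ℚₚ.toℚᵘ-homo-* β (ℕ→ℚ (suc d)))) 1≤[1+p]/[1+d]*[1+d])
  where
  1≤[1+p]/[1+d]*[1+d] : ℚᵘ.1ℚᵘ ℚᵘ.≤ ℚ.toℚᵘ β ℚᵘ.* ℚ.toℚᵘ (ℕ→ℚ (suc d))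
  1≤[1+p]/[1+d]*[1+d] rewrite ℕ→ℚ≡mkℚ (suc d) = ℚᵘ.*≤* (ℤ.+≤+ (s≤s d≤d+p[1+d]))
    where
    d≤d+p[1+d] : d * 1 + 0 * suc (d * 1) ≤ (d + p * suc d) * 1
    d≤d+p[1+d] rewrite ℕₚ.*-identityʳ d | ℕₚ.*-identityʳ (d + p * suc d) | ℕₚ.+-identityʳ d =
      ℕₚ.m≤m+n d (p * suc d)
1≤β*denominator {ℚ.mkℚ (ℤ.+ 0)     _ _} (ℚ.*<* (ℤ.+<+ ()))
1≤β*denominator {ℚ.mkℚ ℤ.-[1+ _ ] _ _} (ℚ.*<* ())

does≡false⇒¬ : ∀ {P : Set} (p? : Dec P) → does p? ≡ false → ¬ P
does≡false⇒¬ (no ¬p) _ = ¬p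

does≡true⇒ : ∀ {P : Set} (p? : Dec P) → does p? ≡ true → P
does≡true⇒ (yes p) _ = p

not≡true⇒≡false : ∀ {b} → not b ≡ true → b ≡ false
not≡true⇒≡false {false} _ = refl

∧≡true⇒ : ∀ {a b} → a ∧ b ≡ true → a ≡ true × b ≡ true
∧≡true⇒ {true} {true} _ = refl , refl

private variable A B : Set

sumOf : (A → ℕ) → List A → ℕ
sumOf f xs = sum (map f xs)

count : (A → Bool) → List A → ℕ
count p xs = length (filter p xs)

sumOf-cong : ∀ {f g : A → ℕ} xs → (∀ x → f x ≡ g x) → sumOf f xs ≡ sumOf g xs
sumOf-cong []       f≗g = refl
sumOf-cong (x ∷ xs) f≗g = cong₂ _+_ (f≗g x) (sumOf-cong xs f≗g)

sumOf-mono : ∀ {f g : A → ℕ} {xs} → All (λ x → f x ≤ g x) xs → sumOf f xs ≤ sumOf g xs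
sumOf-mono []         = z≤n
sumOf-mono (le ∷ les) = ℕₚ.+-mono-≤ le (sumOf-mono les)

sumOf-zero : ∀ (xs : List A) → sumOf (λ _ → 0) xs ≡ 0
sumOf-zero []       = refl
sumOf-zero (x ∷ xs) = sumOf-zero xs

sumOf-const : ∀ c (xs : List A) → sumOf (λ _ → c) xs ≡ length xs * c
sumOf-const c []       = refl
sumOf-const c (x ∷ xs) = cong (c +_) (sumOf-const c xs)

sumOf-+ : ∀ (f g : A → ℕ) xs → sumOf (λ x → f x + g x) xs ≡ sumOf f xs + sumOf g xs
sumOf-+ f g []       = refl
sumOf-+ f g (x ∷ xs) =
  trans (cong (f x + g x +_) (sumOf-+ f g xs)) (+-interchange (f x) (g x) (sumOf f xs) (sumOf g xs))

sumOf-*ˡ : ∀ c (f : A → ℕ) xs → sumOf (λ x → c * f x) xs ≡ c * sumOf f xs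
sumOf-*ˡ c f []       = ≡.sym (ℕₚ.*-zeroʳ c)
sumOf-*ˡ c f (x ∷ xs) =
  trans (cong (c * f x +_) (sumOf-*ˡ c f xs)) (≡.sym (ℕₚ.*-distribˡ-+ c (f x) (sumOf f xs)))

sumOf-swap : ∀ (f : A → B → ℕ) xs ys →
  sumOf (λ x → sumOf (f x) ys) xs ≡ sumOf (λ y → sumOf (λ x → f x y) xs) ys
sumOf-swap f []       ys = ≡.sym (sumOf-zero ys)
sumOf-swap f (x ∷ xs) ys = trans (cong (sumOf (f x) ys +_) (sumOf-swap f xs ys))
  (≡.sym (sumOf-+ (f x) (λ y → sumOf (λ x → f x y) xs) ys))

∈⇒≤-sumOf : ∀ (f : A → ℕ) {a xs} → a ∈ xs → f a ≤ sumOf f xs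
∈⇒≤-sumOf f {xs = y ∷ xs} (here refl) = ℕₚ.m≤m+n (f y) (sumOf f xs)
∈⇒≤-sumOf f {xs = y ∷ xs} (there a∈xs) = ℕₚ.≤-trans (∈⇒≤-sumOf f a∈xs) (ℕₚ.m≤n+m _ (f y))

Any-≤-sumOf : ∀ {c} (g : A → ℕ) {xs} → Any (λ x → c ≤ g x) xs → c ≤ sumOf g xs
Any-≤-sumOf g {x ∷ xs} (here c≤gx) = ℕₚ.≤-trans c≤gx (ℕₚ.m≤m+n (g x) (sumOf g xs))
Any-≤-sumOf g {x ∷ xs} (there any) = ℕₚ.≤-trans (Any-≤-sumOf g any) (ℕₚ.m≤n+m _ (g x))

sumOf-filter : ∀ (f : A → ℕ) q xs → sumOf f (filter q xs) ≡ sumOf (λ x → if q x then f x else 0) xs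
sumOf-filter f q []       = refl
sumOf-filter f q (x ∷ xs) with q x
... | true  = cong (f x +_) (sumOf-filter f q xs)
... | false = sumOf-filter f q xs

sumOf-if : ∀ (q : A → Bool) c xs → sumOf (λ x → if q x then c else 0) xs ≡ count q xs * c
sumOf-if q c xs = trans (≡.sym (sumOf-filter (λ _ → c) q xs)) (sumOf-const c (filter q xs))

sumOf-filter-≤ : ∀ (f : A → ℕ) q xs → sumOf f (filter q xs) ≤ sumOf f xs
sumOf-filter-≤ f q []       = z≤n
sumOf-filter-≤ f q (x ∷ xs) with q x
... | true  = ℕₚ.+-monoʳ-≤ (f x) (sumOf-filter-≤ f q xs)
... | false = ℕₚ.≤-trans (sumOf-filter-≤ f q xs) (ℕₚ.m≤n+m _ (f x))

sumOf-filter-cover : ∀ (f : A → ℕ) p (qs : List (A → Bool)) xs →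
  All (λ x → p x ≡ true → Any (λ q → q x ≡ true) qs) xs →
  sumOf f (filter p xs) ≤ sumOf (λ q → sumOf f (filter q xs)) qs
sumOf-filter-cover f p qs xs covered = begin
  sumOf f (filter p xs)                                      ≡⟨ sumOf-filter f p xs ⟩
  sumOf (λ x → if p x then f x else 0) xs                    ≤⟨ sumOf-mono (All.map pointwise covered) ⟩
  sumOf (λ x → sumOf (λ q → if q x then f x else 0) qs) xs   ≡⟨ sumOf-swap _ xs qs ⟩
  sumOf (λ q → sumOf (λ x → if q x then f x else 0) xs) qs   ≡⟨ sumOf-cong qs (λ q → ≡.sym (sumOf-filter f q xs)) ⟩
  sumOf (λ q → sumOf f (filter q xs)) qs                     ∎
  where
  open ℕₚ.≤-Reasoning
  pointwise : ∀ {x} → (p x ≡ true → Any (λ q → q x ≡ true) qs) →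
              (if p x then f x else 0) ≤ sumOf (λ q → if q x then f x else 0) qs
  pointwise {x} cover with p x
  ... | false = z≤n
  ... | true  = Any-≤-sumOf _ (Any.map (λ qx → ℕₚ.≤-reflexive (cong (λ b → if b then f x else 0) (≡.sym qx))) (cover refl))

filter-none : ∀ (q : A → Bool) xs → (∀ x → q x ≡ false) → filter q xs ≡ []
filter-none q []       q≗false = refl
filter-none q (x ∷ xs) q≗false rewrite q≗false x = filter-none q xs q≗false

filter-all : ∀ (q : A → Bool) xs → (∀ x → q x ≡ true) → filter q xs ≡ xs
filter-all q []       q≗true = refl
filter-all q (x ∷ xs) q≗true rewrite q≗true x = cong (x ∷_) (filter-all q xs q≗true)

filter-All : ∀ {P : A → Set} q {xs} → All P xs → All (λ x → q x ≡ true × P x) (filter q xs)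
filter-All q []                   = []
filter-All q {x ∷ xs} (px ∷ pxs) with q x in qx
... | true  = (qx , px) ∷ filter-All q pxs
... | false = filter-All q pxs

Any-filter⁻ : ∀ {P : A → Set} q xs → Any P (filter q xs) → Any (λ x → q x ≡ true × P x) xs
Any-filter⁻ q (x ∷ xs) any with q x in qx | any
... | true  | here px   = here (qx , px)
... | true  | there any = there (Any-filter⁻ q xs any)
... | false | any       = there (Any-filter⁻ q xs any)

length-filter-≤ : ∀ (q : A → Bool) xs → count q xs ≤ length xs
length-filter-≤ q []       = z≤n
length-filter-≤ q (x ∷ xs) with q x
... | true  = s≤s (length-filter-≤ q xs)
... | false = ℕₚ.m≤n⇒m≤1+n (length-filter-≤ q xs)

count-++ : ∀ (q : A → Bool) xs ys → count q (xs ++ ys) ≡ count q xs + count q ys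
count-++ q []       ys = refl
count-++ q (x ∷ xs) ys with q x
... | true  = cong suc (count-++ q xs ys)
... | false = count-++ q xs ys

count-map : ∀ (q : B → Bool) (f : A → B) xs → count q (map f xs) ≡ count (λ x → q (f x)) xs
count-map q f []       = refl
count-map q f (x ∷ xs) with q (f x)
... | true  = cong suc (count-map q f xs)
... | false = count-map q f xs

count-cons : ∀ (P : A → Bool) v (X : List (List A)) →
  count (all P) (map (v ∷_) X) ≡ (if P v then count (all P) X else 0)
count-cons P v X with P v | count-map (all P) (v ∷_) X
... | true  | eq = eq
... | false | eq = trans eq (cong length (filter-none _ X (λ _ → refl)))

count-concatMap : ∀ (q : B → Bool) (f : A → List B) xs →
  count q (concatMap f xs) ≡ sumOf (λ x → count q (f x)) xs
count-concatMap q f []       = refl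
count-concatMap q f (x ∷ xs) =
  trans (count-++ q (f x) (concatMap f xs)) (cong (count q (f x) +_) (count-concatMap q f xs))

count-split : ∀ (p q : A → Bool) xs →
  count p xs ≡ count (λ x → p x ∧ q x) xs + count (λ x → p x ∧ not (q x)) xs
count-split p q []       = refl
count-split p q (x ∷ xs) with p x | q x
... | true  | true  = cong suc (count-split p q xs)
... | true  | false = trans (cong suc (count-split p q xs)) (≡.sym (ℕₚ.+-suc _ _))
... | false | _     = count-split p q xs

count≡sumOf : ∀ (q : A → Bool) xs → count q xs ≡ sumOf (λ x → if q x then 1 else 0) xs
count≡sumOf q []       = refl
count≡sumOf q (x ∷ xs) with q x
... | true  = cong suc (count≡sumOf q xs)
... | false = count≡sumOf q xs

all-false : ∀ (q : A → Bool) xs → all q xs ≡ false → Any (λ x → q x ≡ false) xs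
all-false q (x ∷ xs) eq with q x in qx
... | false = here qx
... | true  = there (all-false q xs eq)

all-∧ : ∀ (p q : A → Bool) xs → all (λ x → p x ∧ q x) xs ≡ all p xs ∧ all q xs
all-∧ p q []       = refl
all-∧ p q (x ∷ xs) rewrite all-∧ p q xs = ∧-interchange (p x) (q x) (all p xs) (all q xs)

all-cong : ∀ {p q : A → Bool} xs → (∀ x → p x ≡ q x) → all p xs ≡ all q xs
all-cong []       p≗q = refl
all-cong (x ∷ xs) p≗q = cong₂ _∧_ (p≗q x) (all-cong xs p≗q)

all-true : ∀ (xs : List A) → all (λ _ → true) xs ≡ true
all-true []       = refl
all-true (x ∷ xs) = all-true xs

all-swap : ∀ (R : A → B → Bool) xs ys → all (λ y → all (λ x → R x y) xs) ys ≡ all (λ x → all (R x) ys) xs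
all-swap R xs []       = ≡.sym (all-true xs)
all-swap R xs (y ∷ ys) rewrite all-swap R xs ys = ≡.sym (all-∧ (λ x → R x y) (λ x → all (R x) ys) xs)

-- Comparisons of r-th roots

module RootComparison (r′ : ℕ) {Q P : ℚ} (0≤Q : 0ℚ ≤ℚ Q) (0≤P : 0ℚ ≤ℚ P) where

  r : ℕ
  r = suc r′

  -- a ≼ c  says  a · Q^(1/r) ≤ c · P^(1/r).
  infix 4 _≼_
  _≼_ : ℕ → ℕ → Set
  a ≼ c = ℕ→ℚ (a ^ r) *ℚ Q ≤ℚ ℕ→ℚ (c ^ r) *ℚ P

  private
    -- b/d ≤ a/c implies (a + b)/(c + d) ≤ a/c.
    ≼-+-ordered : ∀ {a b c d} → b * c ≤ a * d → a ≼ c → b ≼ d → (a + b) ≼ (c + d)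
    ≼-+-ordered {zero}  {c = zero}      _     _   b≼d = b≼d
    ≼-+-ordered {suc a} {b} {zero} {d} _     a≼0 _   =
      ℚₚ.≤-trans (ℚₚ.≤-reflexive lhs≡0) (*ℚ-nonNeg (ℕ→ℚ-nonNeg ((0 + d) ^ r)) 0≤P)
      where
      A⁺ : Positive (ℕ→ℚ (suc a ^ r))
      A⁺ = ℚ.positive (ℕ→ℚ-pos (ℕₚ.m^n>0 (suc a) r))
      Q≤0 : Q ≤ℚ 0ℚ
      Q≤0 = ℚₚ.*-cancelˡ-≤-pos (ℕ→ℚ (suc a ^ r)) {{A⁺}}
              (subst (ℕ→ℚ (suc a ^ r) *ℚ Q ≤ℚ_) (trans (ℚₚ.*-zeroˡ P) (≡.sym (ℚₚ.*-zeroʳ (ℕ→ℚ (suc a ^ r))))) a≼0)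
      lhs≡0 : ℕ→ℚ ((suc a + b) ^ r) *ℚ Q ≡ 0ℚ
      lhs≡0 = trans (cong (ℕ→ℚ ((suc a + b) ^ r) *ℚ_) (ℚₚ.≤-antisym Q≤0 0≤Q)) (ℚₚ.*-zeroʳ (ℕ→ℚ ((suc a + b) ^ r)))
    ≼-+-ordered {a} {b} {suc c} {d} bc≤ad a≼c _ =
      ℚₚ.*-cancelʳ-≤-pos C {{ℚ.positive (ℕ→ℚ-pos (ℕₚ.m^n>0 (suc c) r))}} (begin
        ℕ→ℚ ((a + b) ^ r) *ℚ Q *ℚ C             ≡⟨ *ℚ-right-comm (ℕ→ℚ ((a + b) ^ r)) Q C ⟩
        ℕ→ℚ ((a + b) ^ r) *ℚ C *ℚ Q             ≡⟨ cong (_*ℚ Q) (≡.sym (ℕ→ℚ-* ((a + b) ^ r) (suc c ^ r))) ⟩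
        ℕ→ℚ ((a + b) ^ r * suc c ^ r) *ℚ Q      ≤⟨ *ℚ-monoʳ-≤ Q 0≤Q (ℕ→ℚ-mono-≤ (^-mediant-≤ r {a} {b} {suc c} {d} bc≤ad)) ⟩
        ℕ→ℚ (a ^ r * (suc c + d) ^ r) *ℚ Q      ≡⟨ cong (_*ℚ Q) (ℕ→ℚ-* (a ^ r) ((suc c + d) ^ r)) ⟩
        ℕ→ℚ (a ^ r) *ℚ D *ℚ Q                   ≡⟨ *ℚ-swap-left (ℕ→ℚ (a ^ r)) D Q ⟩
        D *ℚ (ℕ→ℚ (a ^ r) *ℚ Q)                 ≤⟨ *ℚ-monoˡ-≤ D (ℕ→ℚ-nonNeg ((suc c + d) ^ r)) a≼c ⟩
        D *ℚ (C *ℚ P)                           ≡⟨ *ℚ-swap-right D C P ⟩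
        D *ℚ P *ℚ C                             ∎)
      where
      open ℚₚ.≤-Reasoning
      C D : ℚ
      C = ℕ→ℚ (suc c ^ r)
      D = ℕ→ℚ ((suc c + d) ^ r)

  ≼-+ : ∀ {a b c d} → a ≼ c → b ≼ d → (a + b) ≼ (c + d)
  ≼-+ {a} {b} {c} {d} a≼c b≼d with ℕₚ.≤-total (b * c) (a * d)
  ... | inj₁ bc≤ad = ≼-+-ordered {a} {b} {c} {d} bc≤ad a≼c b≼d
  ... | inj₂ ad≤bc = subst₂ _≼_ (ℕₚ.+-comm b a) (ℕₚ.+-comm d c) (≼-+-ordered {b} {a} {d} {c} ad≤bc b≼d a≼c)

  ≼-sum : ∀ (f g : A → ℕ) {xs} → All (λ x → f x ≼ g x) xs → sumOf f xs ≼ sumOf g xs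
  ≼-sum f g {[]}     []          = ℚₚ.≤-reflexive (trans (ℚₚ.*-zeroˡ Q) (≡.sym (ℚₚ.*-zeroˡ P)))
  ≼-sum f g {x ∷ xs} (fx≼gx ∷ h) = ≼-+ {f x} {sumOf f xs} {g x} {sumOf g xs} fx≼gx (≼-sum f g h)

module _ {n : ℕ} (G : Graph n) where

  seqs-length : ∀ k → All (λ S → length S ≡ k) (seqs G k)
  seqs-length zero    = refl ∷ []
  seqs-length (suc k) = extend (allFin n)
    where
    extend : ∀ vs → All (λ S → length S ≡ suc k) (concatMap (λ v → map (v ∷_) (seqs G k)) vs)
    extend []       = []
    extend (v ∷ vs) = Allₚ.++⁺ (Allₚ.map⁺ (All.map (cong suc) (seqs-length k))) (extend vs)

  count-all-seqs : ∀ (P : Fin n → Bool) k → count (all P) (seqs G k) ≡ count P (allFin n) ^ k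
  count-all-seqs P zero    = refl
  count-all-seqs P (suc k) = begin
    count (all P) (concatMap (λ v → map (v ∷_) (seqs G k)) (allFin n))   ≡⟨ count-concatMap (all P) _ (allFin n) ⟩
    sumOf (λ v → count (all P) (map (v ∷_) (seqs G k))) (allFin n)      ≡⟨ sumOf-cong (allFin n) (λ v → count-cons P v (seqs G k)) ⟩
    sumOf (λ v → if P v then count (all P) (seqs G k) else 0) (allFin n) ≡⟨ sumOf-if P _ (allFin n) ⟩
    count P (allFin n) * count (all P) (seqs G k)                        ≡⟨ cong (count P (allFin n) *_) (count-all-seqs P k) ⟩
    count P (allFin n) ^ suc k                                           ∎
    where open ≡-Reasoning

  length-seqs : ∀ k → length (seqs G k) ≡ n ^ k
  length-seqs k = begin
    length (seqs G k)                          ≡⟨ cong length (filter-all (all (λ _ → true)) (seqs G k) all-true) ⟨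
    count (all (λ _ → true)) (seqs G k)        ≡⟨ count-all-seqs (λ _ → true) k ⟩
    count (λ _ → true) (allFin n) ^ k          ≡⟨ cong (λ xs → length xs ^ k) (filter-all _ (allFin n) (λ _ → refl)) ⟩
    length (allFin n) ^ k                      ≡⟨ cong (_^ k) (Listₚ.length-tabulate (λ i → i)) ⟩
    n ^ k                                      ∎
    where open ≡-Reasoning

  cardN-^ : ∀ S k → cardN G S ^ k ≡ count (all (inN G S)) (seqs G k)
  cardN-^ S k = ≡.sym (count-all-seqs (inN G S) k)

  cardN-∷-≤-deg : ∀ s S → cardN G (s ∷ S) ≤ deg G s
  cardN-∷-≤-deg s S = subst (cardN G (s ∷ S) ≤_) (≡.sym split) (ℕₚ.m≤m+n (cardN G (s ∷ S)) _)
    where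
    split : deg G s ≡ cardN G (s ∷ S) + count (λ v → adj G s v ∧ not (inN G S v)) (allFin n)
    split = count-split (adj G s) (inN G S) (allFin n)

  inN-sym : ∀ S T → all (inN G S) T ≡ all (inN G T) S
  inN-sym S T = trans (all-swap (adj G) S T) (all-cong S (λ s → all-cong T (λ t → sym G s t)))

  double-counting : ∀ (bad : List (Fin n) → Bool) j k →
    sumOf (λ S → count (λ T → all (inN G S) T ∧ bad T) (seqs G k)) (seqs G j)
      ≡ sumOf (λ T → cardN G T ^ j) (filter bad (seqs G k))
  double-counting bad j k = begin
    sumOf (λ S → count (λ T → all (inN G S) T ∧ bad T) (seqs G k)) (seqs G j)
      ≡⟨ sumOf-cong (seqs G j) (λ S → count≡sumOf _ (seqs G k)) ⟩
    sumOf (λ S → sumOf (λ T → if all (inN G S) T ∧ bad T then 1 else 0) (seqs G k)) (seqs G j)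
      ≡⟨ sumOf-swap _ (seqs G j) (seqs G k) ⟩
    sumOf (λ T → sumOf (λ S → if all (inN G S) T ∧ bad T then 1 else 0) (seqs G j)) (seqs G k)
      ≡⟨ sumOf-cong (seqs G k) neighbours ⟩
    sumOf (λ T → if bad T then cardN G T ^ j else 0) (seqs G k)
      ≡⟨ sumOf-filter _ bad (seqs G k) ⟨
    sumOf (λ T → cardN G T ^ j) (filter bad (seqs G k)) ∎
    where
    open ≡-Reasoning
    neighbours : ∀ T → sumOf (λ S → if all (inN G S) T ∧ bad T then 1 else 0) (seqs G j)
                         ≡ (if bad T then cardN G T ^ j else 0)
    neighbours T with bad T
    ... | false = trans (sumOf-cong (seqs G j) (λ S → cong (λ b → if b then 1 else 0) (Boolₚ.∧-zeroʳ (all (inN G S) T))))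
                        (sumOf-zero (seqs G j))
    ... | true  = begin
      sumOf (λ S → if all (inN G S) T ∧ true then 1 else 0) (seqs G j)
        ≡⟨ sumOf-cong (seqs G j) (λ S → cong (λ b → if b then 1 else 0) (trans (Boolₚ.∧-identityʳ _) (inN-sym S T))) ⟩
      sumOf (λ S → if all (inN G T) S then 1 else 0) (seqs G j)
        ≡⟨ count≡sumOf _ (seqs G j) ⟨
      count (all (inN G T)) (seqs G j)
        ≡⟨ cardN-^ T j ⟨
      cardN G T ^ j ∎

tStar-nonNeg : ∀ {n} (G : Graph n) r → 0ℚ ≤ℚ tStar G r
tStar-nonNeg {zero}  G r = ℚₚ.≤-refl
tStar-nonNeg {suc m} G r = ℚₚ.nonNegative⁻¹ _
  {{ℚₚ.normalize-nonNeg (sumOf (λ v → deg G v ^ r) (allFin (suc m))) (suc m ^ suc r) {{ℕₚ.m^n≢0 (suc m) (suc r)}}}}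

tStar-pos⇒1≤n : ∀ {n} (G : Graph n) r → 0ℚ < tStar G r → 1 ≤ n
tStar-pos⇒1≤n {zero}  G r 0<0 = ⊥-elim (ℚₚ.<-irrefl refl 0<0)
tStar-pos⇒1≤n {suc n} G r _   = s≤s z≤n

ratio≡0⇒≡0 : ∀ D m r → ratio D (suc m) r ≡ 0ℚ → D ≡ 0
ratio≡0⇒≡0 zero    m r _   = refl
ratio≡0⇒≡0 (suc D) m r eq = ⊥-elim (ℚₚ.<-irrefl (≡.sym eq)
  (ℚₚ.positive⁻¹ _ {{ℚₚ.normalize-pos (suc D) (suc m ^ suc r) {{ℕₚ.m^n≢0 (suc m) (suc r)}}}}))

tStar≡0⇒deg≡0 : ∀ {n} (G : Graph n) r′ → tStar G (suc r′) ≡ 0ℚ → ∀ v → deg G v ≡ 0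
tStar≡0⇒deg≡0 {suc m} G r′ t≡0 v = ℕₚ.m^n≡0⇒m≡0 (deg G v) (suc r′) (ℕₚ.n≤0⇒n≡0
  (subst (deg G v ^ suc r′ ≤_) (ratio≡0⇒≡0 _ m (suc r′) t≡0) (∈⇒≤-sumOf (λ u → deg G u ^ suc r′) (∈-allFin v))))

badSum≡0 : ∀ {n} (G : Graph n) r′ → tStar G (suc r′) ≡ 0ℚ →
  ∀ α β h i j ℓ → Goodness.badSum G α β h (suc r′) i (suc j) (suc ℓ) ≡ 0
badSum≡0 G r′ t≡0 α β h i j ℓ = ℕₚ.n≤0⇒n≡0 (ℕₚ.≤-trans
  (sumOf-mono (All.map (λ {S} (_ , |S|≡1+j) → vanish S |S|≡1+j) (filter-All _ (seqs-length G (suc j)))))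
  (ℕₚ.≤-reflexive (sumOf-zero (filter (λ S → not (Goodness.good G α β h (suc r′) i S)) (seqs G (suc j))))))
  where
  vanish : ∀ S → length S ≡ suc j → cardN G S ^ suc ℓ ≤ 0
  vanish (s ∷ S) _ = ℕₚ.*-monoˡ-≤ (cardN G (s ∷ S) ^ ℓ)
    (subst (cardN G (s ∷ S) ≤_) (tStar≡0⇒deg≡0 G r′ t≡0 s) (cardN-∷-≤-deg G s S))

-- Bounds a ≤ c · p^e

module Density {n : ℕ} (G : Graph n) (r′ : ℕ) where

  r : ℕ
  r = suc r′

  t : ℚ
  t = tStar G r

  t^-nonNeg : ∀ e → 0ℚ ≤ℚ t ^ℚ e
  t^-nonNeg e = ^ℚ-nonNeg e (tStar-nonNeg G r)

  -- a ≲ c ·p^ e  says  a ≤ c · p^e  for  p = t^(1/r).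
  infix 4 _≲_·p^_
  record _≲_·p^_ (a c e : ℕ) : Set where
    constructor ≲-intro
    field ≲-elim : ℕ→ℚ (a ^ r) ≤ℚ ℕ→ℚ (c ^ r) *ℚ (t ^ℚ e)

  0≲ : ∀ c e → 0 ≲ c ·p^ e
  0≲ c e = ≲-intro (*ℚ-nonNeg (ℕ→ℚ-nonNeg (c ^ r)) (t^-nonNeg e))

  ≲-monoˡ : ∀ {a a′ c e} → a′ ≤ a → a ≲ c ·p^ e → a′ ≲ c ·p^ e
  ≲-monoˡ a′≤a (≲-intro le) = ≲-intro (ℚₚ.≤-trans (ℕ→ℚ-mono-≤ (ℕₚ.^-monoˡ-≤ r a′≤a)) le)

  ≲-monoʳ : ∀ {a c c′ e} → c ≤ c′ → a ≲ c ·p^ e → a ≲ c′ ·p^ e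
  ≲-monoʳ {e = e} c≤c′ (≲-intro le) =
    ≲-intro (ℚₚ.≤-trans le (*ℚ-monoʳ-≤ (t ^ℚ e) (t^-nonNeg e) (ℕ→ℚ-mono-≤ (ℕₚ.^-monoˡ-≤ r c≤c′))))

  ≲-sum : ∀ {e} (f g : A → ℕ) {xs} → All (λ x → f x ≲ g x ·p^ e) xs → sumOf f xs ≲ sumOf g xs ·p^ e
  ≲-sum {e = e} f g {xs} fx≲gx = ≲-intro (subst (_≤ℚ _) (ℚₚ.*-identityʳ _) (≼-sum f g (All.map to≼ fx≲gx)))
    where
    open RootComparison r′ (ℚₚ.nonNegative⁻¹ 1ℚ) (t^-nonNeg e) using (_≼_; ≼-sum)
    to≼ : ∀ {a c} → a ≲ c ·p^ e → a ≼ c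
    to≼ {a} (≲-intro le) = subst (_≤ℚ _) (≡.sym (ℚₚ.*-identityʳ (ℕ→ℚ (a ^ r)))) le

  ≲-^ : ∀ {a c e} m → a ≲ c ·p^ e → a ^ m ≲ c ^ m ·p^ (e * m)
  ≲-^ {a} {c} {e} m (≲-intro le) = ≲-intro (begin
    ℕ→ℚ ((a ^ m) ^ r)                            ≡⟨ cong ℕ→ℚ (^-comm a m r) ⟩
    ℕ→ℚ ((a ^ r) ^ m)                            ≡⟨ ℕ→ℚ-^ (a ^ r) m ⟩
    ℕ→ℚ (a ^ r) ^ℚ m                             ≤⟨ ^ℚ-monoˡ-≤ m (ℕ→ℚ-nonNeg (a ^ r)) le ⟩
    (ℕ→ℚ (c ^ r) *ℚ t ^ℚ e) ^ℚ m                 ≡⟨ ^ℚ-distribʳ-* (ℕ→ℚ (c ^ r)) (t ^ℚ e) m ⟩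
    ℕ→ℚ (c ^ r) ^ℚ m *ℚ (t ^ℚ e) ^ℚ m            ≡⟨ cong₂ _*ℚ_ (≡.sym (ℕ→ℚ-^ (c ^ r) m)) (^ℚ-*-assoc t e m) ⟩
    ℕ→ℚ ((c ^ r) ^ m) *ℚ t ^ℚ (e * m)            ≡⟨ cong (λ x → ℕ→ℚ x *ℚ t ^ℚ (e * m)) (^-comm c r m) ⟩
    ℕ→ℚ ((c ^ m) ^ r) *ℚ t ^ℚ (e * m)            ∎)
    where open ℚₚ.≤-Reasoning

  ≲-cancel : ∀ {a c e} m → 1 ≤ m → m * a ≲ m * c ·p^ e → a ≲ c ·p^ e
  ≲-cancel {a} {c} {e} m 1≤m (≲-intro le) =
    ≲-intro (ℚₚ.*-cancelˡ-≤-pos M {{ℚ.positive (ℕ→ℚ-pos (ℕₚ.≤-trans 1≤m (≤-^ m r (s≤s z≤n))))}} (begin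
      M *ℚ ℕ→ℚ (a ^ r)                   ≡⟨ ℕ→ℚ-* (m ^ r) (a ^ r) ⟨
      ℕ→ℚ (m ^ r * a ^ r)                ≡⟨ cong ℕ→ℚ (^-distribʳ-* m a r) ⟨
      ℕ→ℚ ((m * a) ^ r)                  ≤⟨ le ⟩
      ℕ→ℚ ((m * c) ^ r) *ℚ t ^ℚ e        ≡⟨ cong (λ x → ℕ→ℚ x *ℚ t ^ℚ e) (^-distribʳ-* m c r) ⟩
      ℕ→ℚ (m ^ r * c ^ r) *ℚ t ^ℚ e      ≡⟨ cong (_*ℚ t ^ℚ e) (ℕ→ℚ-* (m ^ r) (c ^ r)) ⟩
      M *ℚ ℕ→ℚ (c ^ r) *ℚ t ^ℚ e         ≡⟨ ℚₚ.*-assoc M (ℕ→ℚ (c ^ r)) (t ^ℚ e) ⟩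
      M *ℚ (ℕ→ℚ (c ^ r) *ℚ t ^ℚ e)       ∎))
    where
    open ℚₚ.≤-Reasoning
    M : ℚ
    M = ℕ→ℚ (m ^ r)

  Large : ℕ → ℕ → List (Fin n) → Set
  Large A j S = ℕ→ℚ (n ^ r) *ℚ t ^ℚ j ≤ℚ ℕ→ℚ ((A * cardN G S) ^ r)

  -- Opaque: unfolding this rational comparison during unification blows up.
  opaque
    Large? : ∀ A j S → Dec (Large A j S)
    Large? A j S = ℕ→ℚ (n ^ r) *ℚ t ^ℚ j ℚₚ.≤? ℕ→ℚ ((A * cardN G S) ^ r)

  large? : ℕ → ℕ → List (Fin n) → Bool
  large? A j S = does (Large? A j S)

  ¬Large⇒≲ : ∀ {A j S} → ¬ Large A j S → A * cardN G S ≲ n ·p^ j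
  ¬Large⇒≲ ¬large = ≲-intro (ℚₚ.<⇒≤ (ℚₚ.≰⇒> ¬large))

  sumOf-small-≲ : ∀ A {j ℓ} → 1 ≤ ℓ → (p : List (Fin n) → Bool) →
    (∀ S → length S ≡ j → p S ≡ true → ¬ Large A j S) →
    A * sumOf (λ S → cardN G S ^ ℓ) (filter p (seqs G j)) ≲ n ^ (j + ℓ) ·p^ (j * ℓ)
  sumOf-small-≲ A {j} {ℓ} 1≤ℓ p small =
    ≲-monoʳ length-bound (subst (_≲ sumOf (λ _ → n ^ ℓ) F ·p^ (j * ℓ)) (sumOf-*ˡ A (λ S → cardN G S ^ ℓ) F)
      (≲-sum _ _ (All.map term (filter-All p (seqs-length G j)))))
    where
    F : List (List (Fin n))
    F = filter p (seqs G j)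
    term : ∀ {S} → p S ≡ true × length S ≡ j → A * cardN G S ^ ℓ ≲ n ^ ℓ ·p^ (j * ℓ)
    term {S} (pS , |S|≡j) = ≲-monoˡ A*xˡ≤[A*x]ˡ (≲-^ ℓ (¬Large⇒≲ {A} {j} {S} (small S |S|≡j pS)))
      where
      A*xˡ≤[A*x]ˡ : A * cardN G S ^ ℓ ≤ (A * cardN G S) ^ ℓ
      A*xˡ≤[A*x]ˡ = subst (A * cardN G S ^ ℓ ≤_) (≡.sym (^-distribʳ-* A (cardN G S) ℓ))
                          (ℕₚ.*-monoˡ-≤ (cardN G S ^ ℓ) (≤-^ A ℓ 1≤ℓ))
    length-bound : sumOf (λ _ → n ^ ℓ) F ≤ n ^ (j + ℓ)
    length-bound = begin
      sumOf (λ _ → n ^ ℓ) F  ≡⟨ sumOf-const (n ^ ℓ) F ⟩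
      length F * n ^ ℓ       ≤⟨ ℕₚ.*-monoˡ-≤ (n ^ ℓ) (subst (length F ≤_) (length-seqs G j) (length-filter-≤ p (seqs G j))) ⟩
      n ^ j * n ^ ℓ          ≡⟨ ℕₚ.^-distribˡ-+-* n j ℓ ⟨
      n ^ (j + ℓ)            ∎
      where open ℕₚ.≤-Reasoning

  -- Moment._≼_ j d x y  says  x · (n · p^j)^d ≤ y.
  scale : ℕ → ℕ → ℚ
  scale j d = (ℕ→ℚ (n ^ r) *ℚ t ^ℚ j) ^ℚ d

  scale-nonNeg : ∀ j d → 0ℚ ≤ℚ scale j d
  scale-nonNeg j d = ^ℚ-nonNeg d (*ℚ-nonNeg (ℕ→ℚ-nonNeg (n ^ r)) (t^-nonNeg j))

  module Moment (j d : ℕ) = RootComparison r′ (scale-nonNeg j d) (ℚₚ.nonNegative⁻¹ 1ℚ)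

  Large⇒moment-≼ : ∀ E {j ℓ d S} → Large E j S → Moment._≼_ j d (cardN G S ^ ℓ) (E ^ d * cardN G S ^ (ℓ + d))
  Large⇒moment-≼ E {j} {ℓ} {d} {S} large = begin
    ℕ→ℚ ((x ^ ℓ) ^ r) *ℚ scale j d                      ≤⟨ *ℚ-monoˡ-≤ (ℕ→ℚ ((x ^ ℓ) ^ r)) (ℕ→ℚ-nonNeg ((x ^ ℓ) ^ r))
                                                           (^ℚ-monoˡ-≤ d (*ℚ-nonNeg (ℕ→ℚ-nonNeg (n ^ r)) (t^-nonNeg j)) large) ⟩
    ℕ→ℚ ((x ^ ℓ) ^ r) *ℚ ℕ→ℚ ((E * x) ^ r) ^ℚ d         ≡⟨ cong (ℕ→ℚ ((x ^ ℓ) ^ r) *ℚ_) (ℕ→ℚ-^ ((E * x) ^ r) d) ⟨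
    ℕ→ℚ ((x ^ ℓ) ^ r) *ℚ ℕ→ℚ (((E * x) ^ r) ^ d)        ≡⟨ ℕ→ℚ-* ((x ^ ℓ) ^ r) (((E * x) ^ r) ^ d) ⟨
    ℕ→ℚ ((x ^ ℓ) ^ r * ((E * x) ^ r) ^ d)              ≡⟨ cong ℕ→ℚ (^-moment E x ℓ d r) ⟩
    ℕ→ℚ ((E ^ d * x ^ (ℓ + d)) ^ r)                    ≡⟨ ℚₚ.*-identityʳ _ ⟨
    ℕ→ℚ ((E ^ d * x ^ (ℓ + d)) ^ r) *ℚ 1ℚ              ∎
    where
    open ℚₚ.≤-Reasoning
    x : ℕ
    x = cardN G S

  rescale : ∀ j ℓ d → ℕ→ℚ ((n ^ (ℓ + d + j)) ^ r) *ℚ t ^ℚ ((ℓ + d) * j)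
                       ≡ ℕ→ℚ ((n ^ (j + ℓ)) ^ r) *ℚ t ^ℚ (j * ℓ) *ℚ scale j d
  rescale j ℓ d = begin
    ℕ→ℚ ((n ^ (ℓ + d + j)) ^ r) *ℚ t ^ℚ ((ℓ + d) * j)
      ≡⟨ cong₂ _*ℚ_ (trans (cong ℕ→ℚ n-part) (ℕ→ℚ-* ((n ^ (j + ℓ)) ^ r) ((n ^ r) ^ d)))
                    (trans (cong (t ^ℚ_) t-exponent) (^ℚ-distribˡ-+-* t (j * ℓ) (j * d))) ⟩
    (N *ℚ ℕ→ℚ ((n ^ r) ^ d)) *ℚ (t ^ℚ (j * ℓ) *ℚ t ^ℚ (j * d))
      ≡⟨ *ℚ-interchange N (ℕ→ℚ ((n ^ r) ^ d)) (t ^ℚ (j * ℓ)) (t ^ℚ (j * d)) ⟩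
    (N *ℚ t ^ℚ (j * ℓ)) *ℚ (ℕ→ℚ ((n ^ r) ^ d) *ℚ t ^ℚ (j * d))
      ≡⟨ cong (N *ℚ t ^ℚ (j * ℓ) *ℚ_) (cong₂ _*ℚ_ (ℕ→ℚ-^ (n ^ r) d) (≡.sym (^ℚ-*-assoc t j d))) ⟩
    (N *ℚ t ^ℚ (j * ℓ)) *ℚ (ℕ→ℚ (n ^ r) ^ℚ d *ℚ (t ^ℚ j) ^ℚ d)
      ≡⟨ cong (N *ℚ t ^ℚ (j * ℓ) *ℚ_) (^ℚ-distribʳ-* (ℕ→ℚ (n ^ r)) (t ^ℚ j) d) ⟨
    N *ℚ t ^ℚ (j * ℓ) *ℚ scale j d ∎
    where
    open ≡-Reasoning
    N : ℚ
    N = ℕ→ℚ ((n ^ (j + ℓ)) ^ r)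
    n-part : (n ^ (ℓ + d + j)) ^ r ≡ (n ^ (j + ℓ)) ^ r * (n ^ r) ^ d
    n-part = begin
      (n ^ (ℓ + d + j)) ^ r           ≡⟨ cong (λ e → (n ^ e) ^ r) (trans (ℕₚ.+-comm (ℓ + d) j) (≡.sym (ℕₚ.+-assoc j ℓ d))) ⟩
      (n ^ (j + ℓ + d)) ^ r           ≡⟨ cong (_^ r) (ℕₚ.^-distribˡ-+-* n (j + ℓ) d) ⟩
      (n ^ (j + ℓ) * n ^ d) ^ r       ≡⟨ ^-distribʳ-* (n ^ (j + ℓ)) (n ^ d) r ⟩
      (n ^ (j + ℓ)) ^ r * (n ^ d) ^ r ≡⟨ cong ((n ^ (j + ℓ)) ^ r *_) (^-comm n d r) ⟩
      (n ^ (j + ℓ)) ^ r * (n ^ r) ^ d ∎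
    t-exponent : (ℓ + d) * j ≡ j * ℓ + j * d
    t-exponent = trans (ℕₚ.*-comm (ℓ + d) j) (ℕₚ.*-distribˡ-+ j ℓ d)

  lower-moment-≲ : 0ℚ < t → 1 ≤ n → ∀ E {j ℓ d} (F : List (List (Fin n))) → All (Large E j) F →
    E ^ suc d * sumOf (λ S → cardN G S ^ (ℓ + d)) F ≲ n ^ (ℓ + d + j) ·p^ ((ℓ + d) * j) →
    E * sumOf (λ S → cardN G S ^ ℓ) F ≲ n ^ (j + ℓ) ·p^ (j * ℓ)
  lower-moment-≲ 0<t 1≤n E {j} {ℓ} {d} F large (≲-intro higher) =
    ≲-intro (ℚₚ.*-cancelʳ-≤-pos (scale j d) {{ℚ.positive scale-pos}} (begin
      ℕ→ℚ ((E * Z) ^ r) *ℚ scale j d             ≡⟨ cong (_*ℚ scale j d) (ℕ→ℚ-*-^ E Z r) ⟩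
      ℕ→ℚ (E ^ r) *ℚ ℕ→ℚ (Z ^ r) *ℚ scale j d    ≡⟨ ℚₚ.*-assoc (ℕ→ℚ (E ^ r)) (ℕ→ℚ (Z ^ r)) (scale j d) ⟩
      ℕ→ℚ (E ^ r) *ℚ (ℕ→ℚ (Z ^ r) *ℚ scale j d)  ≤⟨ *ℚ-monoˡ-≤ (ℕ→ℚ (E ^ r)) (ℕ→ℚ-nonNeg (E ^ r)) Z≼W ⟩
      ℕ→ℚ (E ^ r) *ℚ (ℕ→ℚ (W ^ r) *ℚ 1ℚ)         ≡⟨ cong (ℕ→ℚ (E ^ r) *ℚ_) (ℚₚ.*-identityʳ (ℕ→ℚ (W ^ r))) ⟩
      ℕ→ℚ (E ^ r) *ℚ ℕ→ℚ (W ^ r)                 ≡⟨ ℕ→ℚ-*-^ E W r ⟨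
      ℕ→ℚ ((E * W) ^ r)                          ≡⟨ cong (λ y → ℕ→ℚ (y ^ r)) E*W≡ ⟩
      ℕ→ℚ ((E ^ suc d * H) ^ r)                  ≤⟨ higher ⟩
      ℕ→ℚ ((n ^ (ℓ + d + j)) ^ r) *ℚ t ^ℚ ((ℓ + d) * j)   ≡⟨ rescale j ℓ d ⟩
      ℕ→ℚ ((n ^ (j + ℓ)) ^ r) *ℚ t ^ℚ (j * ℓ) *ℚ scale j d ∎))
    where
    open ℚₚ.≤-Reasoning
    open Moment j d using (≼-sum)
    Z H W : ℕ
    Z = sumOf (λ S → cardN G S ^ ℓ) F
    H = sumOf (λ S → cardN G S ^ (ℓ + d)) F
    W = sumOf (λ S → E ^ d * cardN G S ^ (ℓ + d)) F
    scale-pos : 0ℚ < scale j d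
    scale-pos = ^ℚ-pos d (*ℚ-pos (ℕ→ℚ-pos (ℕₚ.≤-trans 1≤n (≤-^ n r (s≤s z≤n)))) (^ℚ-pos j 0<t))
    Z≼W : Moment._≼_ j d Z W
    Z≼W = ≼-sum _ _ (All.map (λ {S} → Large⇒moment-≼ E {j} {ℓ} {d} {S}) large)
    E*W≡ : E * W ≡ E ^ suc d * H
    E*W≡ = trans (cong (E *_) (sumOf-*ˡ (E ^ d) (λ S → cardN G S ^ (ℓ + d)) F)) (≡.sym (ℕₚ.*-assoc E (E ^ d) H))

  ≲⇒≤c·p^ : ∀ {β C X N e} → 0ℚ ≤ℚ β → 1ℚ ≤ℚ β *ℚ ℕ→ℚ C → C * X ≲ N ·p^ e →
    ≤c·p^ G r (ℕ→ℚ X) (β *ℚ ℕ→ℚ N) e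
  ≲⇒≤c·p^ {β} {C} {X} {N} {e} 0≤β 1≤β*C (≲-intro CX≲N) = begin
    ℕ→ℚ X ^ℚ r                              ≤⟨ ^ℚ-monoˡ-≤ r (ℕ→ℚ-nonNeg X) X≤β*CX ⟩
    (β *ℚ ℕ→ℚ (C * X)) ^ℚ r                 ≡⟨ ^ℚ-distribʳ-* β (ℕ→ℚ (C * X)) r ⟩
    β ^ℚ r *ℚ ℕ→ℚ (C * X) ^ℚ r              ≡⟨ cong (β ^ℚ r *ℚ_) (ℕ→ℚ-^ (C * X) r) ⟨
    β ^ℚ r *ℚ ℕ→ℚ ((C * X) ^ r)             ≤⟨ *ℚ-monoˡ-≤ (β ^ℚ r) (^ℚ-nonNeg r 0≤β) CX≲N ⟩
    β ^ℚ r *ℚ (ℕ→ℚ (N ^ r) *ℚ t ^ℚ e)       ≡⟨ ℚₚ.*-assoc (β ^ℚ r) (ℕ→ℚ (N ^ r)) (t ^ℚ e) ⟨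
    β ^ℚ r *ℚ ℕ→ℚ (N ^ r) *ℚ t ^ℚ e         ≡⟨ cong (λ y → β ^ℚ r *ℚ y *ℚ t ^ℚ e) (ℕ→ℚ-^ N r) ⟩
    β ^ℚ r *ℚ ℕ→ℚ N ^ℚ r *ℚ t ^ℚ e          ≡⟨ cong (_*ℚ t ^ℚ e) (^ℚ-distribʳ-* β (ℕ→ℚ N) r) ⟨
    (β *ℚ ℕ→ℚ N) ^ℚ r *ℚ t ^ℚ e             ∎
    where
    open ℚₚ.≤-Reasoning
    X≤β*CX : ℕ→ℚ X ≤ℚ β *ℚ ℕ→ℚ (C * X)
    X≤β*CX = begin
      ℕ→ℚ X                   ≡⟨ ℚₚ.*-identityˡ (ℕ→ℚ X) ⟨
      1ℚ *ℚ ℕ→ℚ X             ≤⟨ *ℚ-monoʳ-≤ (ℕ→ℚ X) (ℕ→ℚ-nonNeg X) 1≤β*C ⟩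
      β *ℚ ℕ→ℚ C *ℚ ℕ→ℚ X     ≡⟨ ℚₚ.*-assoc β (ℕ→ℚ C) (ℕ→ℚ X) ⟩
      β *ℚ (ℕ→ℚ C *ℚ ℕ→ℚ X)   ≡⟨ cong (β *ℚ_) (ℕ→ℚ-* C X) ⟨
      β *ℚ ℕ→ℚ (C * X)        ∎

  t≡0⊎0<t : t ≡ 0ℚ ⊎ 0ℚ < t
  t≡0⊎0<t with ℚₚ.<-cmp 0ℚ t
  ... | tri< 0<t _ _ = inj₂ 0<t
  ... | tri≈ _ 0≡t _ = inj₁ (≡.sym 0≡t)
  ... | tri> _ _ t<0 = ⊥-elim (ℚₚ.<-irrefl refl (ℚₚ.<-≤-trans t<0 (tStar-nonNeg G r)))

  0≤c·p^ : ∀ {c} e → 0ℚ ≤ℚ c → ≤c·p^ G r (ℕ→ℚ 0) c e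
  0≤c·p^ {c} e 0≤c = subst (_≤ℚ c ^ℚ r *ℚ t ^ℚ e) (≡.sym (ℚₚ.*-zeroˡ (ℕ→ℚ 0 ^ℚ r′)))
                           (*ℚ-nonNeg (^ℚ-nonNeg r 0≤c) (t^-nonNeg e))

-- Goodness

module GoodnessBounds {n : ℕ} (G : Graph n) (r′ : ℕ) {α β : ℚ} (h : ℕ)
  (A : ℕ) (0≤α : 0ℚ ≤ℚ α) (α*A≡1 : α *ℚ ℕ→ℚ A ≡ 1ℚ)
  (B : ℕ) (1≤β*B : 1ℚ ≤ℚ β *ℚ ℕ→ℚ B) where

  open Density G r′
  open Goodness G α β h r using (good0; good; countGood; badSum; range; ks)

  enough? : ℕ → List (Fin n) → ℕ → Bool
  enough? i S k = does ((1ℚ -ℚ β) *ℚ ℕ→ℚ (cardN G S) ^ℚ k ℚₚ.≤? ℕ→ℚ (countGood i S k))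

  countBad : ℕ → List (Fin n) → ℕ → ℕ
  countBad i S k = count (λ T → all (inN G S) T ∧ not (good i T)) (seqs G k)

  ¬good0⇒¬Large : ∀ S → good0 S ≡ false → ¬ Large A (length S) S
  ¬good0⇒¬Large S ¬good0 large = does≡false⇒¬ (_ ℚₚ.≤? _) ¬good0 (begin
    (α *ℚ ℕ→ℚ n) ^ℚ r *ℚ t ^ℚ length S                  ≡⟨ cong (_*ℚ t ^ℚ length S) (^ℚ-distribʳ-* α (ℕ→ℚ n) r) ⟩
    α ^ℚ r *ℚ ℕ→ℚ n ^ℚ r *ℚ t ^ℚ length S               ≡⟨ cong (λ y → α ^ℚ r *ℚ y *ℚ t ^ℚ length S) (ℕ→ℚ-^ n r) ⟨
    α ^ℚ r *ℚ ℕ→ℚ (n ^ r) *ℚ t ^ℚ length S              ≡⟨ ℚₚ.*-assoc (α ^ℚ r) (ℕ→ℚ (n ^ r)) (t ^ℚ length S) ⟩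
    α ^ℚ r *ℚ (ℕ→ℚ (n ^ r) *ℚ t ^ℚ length S)            ≤⟨ *ℚ-monoˡ-≤ (α ^ℚ r) (^ℚ-nonNeg r 0≤α) large ⟩
    α ^ℚ r *ℚ ℕ→ℚ ((A * cardN G S) ^ r)                 ≡⟨ cong (α ^ℚ r *ℚ_) (trans (ℕ→ℚ-^ (A * cardN G S) r)
                                                             (trans (cong (_^ℚ r) (ℕ→ℚ-* A (cardN G S)))
                                                                    (^ℚ-distribʳ-* (ℕ→ℚ A) (ℕ→ℚ (cardN G S)) r))) ⟩
    α ^ℚ r *ℚ (ℕ→ℚ A ^ℚ r *ℚ ℕ→ℚ (cardN G S) ^ℚ r)      ≡⟨ ℚₚ.*-assoc (α ^ℚ r) (ℕ→ℚ A ^ℚ r) _ ⟨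
    α ^ℚ r *ℚ ℕ→ℚ A ^ℚ r *ℚ ℕ→ℚ (cardN G S) ^ℚ r        ≡⟨ cong (_*ℚ ℕ→ℚ (cardN G S) ^ℚ r)
                                                             (trans (≡.sym (^ℚ-distribʳ-* α (ℕ→ℚ A) r)) (trans (cong (_^ℚ r) α*A≡1) (1^ℚ r))) ⟩
    1ℚ *ℚ ℕ→ℚ (cardN G S) ^ℚ r                          ≡⟨ ℚₚ.*-identityˡ _ ⟩
    ℕ→ℚ (cardN G S) ^ℚ r                                ∎)
    where open ℚₚ.≤-Reasoning

  ¬enough⇒≤ : ∀ i S k → enough? i S k ≡ false → cardN G S ^ k ≤ B * countBad i S k
  ¬enough⇒≤ i S k ¬enough = ℕ→ℚ-cancel-≤ (begin
    X                          ≡⟨ ℚₚ.*-identityˡ X ⟨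
    1ℚ *ℚ X                    ≤⟨ *ℚ-monoʳ-≤ X (ℕ→ℚ-nonNeg (cardN G S ^ k)) 1≤β*B ⟩
    β *ℚ ℕ→ℚ B *ℚ X            ≡⟨ *ℚ-swap-left β (ℕ→ℚ B) X ⟩
    ℕ→ℚ B *ℚ (β *ℚ X)          ≤⟨ *ℚ-monoˡ-≤ (ℕ→ℚ B) (ℕ→ℚ-nonNeg B) (ℚₚ.<⇒≤ βX<#bad) ⟩
    ℕ→ℚ B *ℚ ℕ→ℚ #bad           ≡⟨ ℕ→ℚ-* B #bad ⟨
    ℕ→ℚ (B * #bad)              ∎)
    where
    open ℚₚ.≤-Reasoning
    #good #bad : ℕ
    #good = countGood i S k
    #bad  = countBad i S k
    X : ℚ
    X = ℕ→ℚ (cardN G S ^ k)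
    #good<[1-β]X : ℕ→ℚ #good < (1ℚ -ℚ β) *ℚ X
    #good<[1-β]X = subst (λ y → ℕ→ℚ #good < (1ℚ -ℚ β) *ℚ y) (≡.sym (ℕ→ℚ-^ (cardN G S) k))
                        (ℚₚ.≰⇒> (does≡false⇒¬ (_ ℚₚ.≤? _) ¬enough))
    X≡#good+#bad : X ≡ ℕ→ℚ #good +ℚ ℕ→ℚ #bad
    X≡#good+#bad = trans (cong ℕ→ℚ (trans (cardN-^ G S k) (count-split (all (inN G S)) (good i) (seqs G k))))
                       (ℕ→ℚ-+ #good #bad)
    βX<#bad : β *ℚ X < ℕ→ℚ #bad
    βX<#bad = +ℚ-cancelˡ-< (ℕ→ℚ #good) (begin-strict
      ℕ→ℚ #good +ℚ β *ℚ X               <⟨ ℚₚ.+-monoˡ-< (β *ℚ X) #good<[1-β]X ⟩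
      (1ℚ -ℚ β) *ℚ X +ℚ β *ℚ X         ≡⟨ [1-β]x+βx≡x β X ⟩
      X                                ≡⟨ X≡#good+#bad ⟩
      ℕ→ℚ #good +ℚ ℕ→ℚ #bad              ∎)

  failsAt : ℕ → ℕ → ℕ → ℕ → List (Fin n) → Bool
  failsAt i E j k S = large? E j S ∧ (does (j ≤? k) ∧ not (enough? i S k))

  pieces : ℕ → ℕ → ℕ → List (List (Fin n) → Bool)
  pieces i E j = (λ S → not (good0 S)) ∷ (λ S → not (large? E j S)) ∷ map (failsAt i E j) (range h)

  length-pieces : ∀ i E j → length (pieces i E j) ≡ 3 + h
  length-pieces i E j = cong (λ l → suc (suc l)) (trans (Listₚ.length-map (failsAt i E j) (range h)) (length-range h))
    where
    length-range : ∀ m → length (range m) ≡ suc m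
    length-range zero    = refl
    length-range (suc m) = cong suc (length-range m)

  range-≤ : ∀ m → All (_≤ m) (range m)
  range-≤ zero    = z≤n ∷ []
  range-≤ (suc m) = ℕₚ.≤-refl ∷ All.map ℕₚ.m≤n⇒m≤1+n (range-≤ m)

  bad-covered : ∀ i E {j} → j ≤ h → ∀ S → length S ≡ j → not (good (suc i) S) ≡ true →
    Any (λ q → q S ≡ true) (pieces i E j)
  bad-covered i E j≤h S refl bad = by-cases (good0 S) refl (large? E (length S) S) refl
    where
    by-cases : ∀ b → good0 S ≡ b → ∀ c → large? E (length S) S ≡ c → Any (λ q → q S ≡ true) (pieces i E (length S))
    by-cases false good0≡ _     _      = here (cong not good0≡)
    by-cases true  good0≡ false large≡ = there (here (cong not large≡))
    by-cases true  good0≡ true  large≡ =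
      there (there (Anyₚ.map⁺ (Any.map failing (Any-filter⁻ _ (range h) (all-false (enough? i S) (ks S) not-enough)))))
      where
      not-enough : all (enough? i S) (ks S) ≡ false
      not-enough = third-false (dec-true (length S ≤? h) j≤h) good0≡ (not≡true⇒≡false bad)
        where
        third-false : ∀ {a b c} → a ≡ true → b ≡ true → a ∧ b ∧ c ≡ false → c ≡ false
        third-false refl refl c≡false = c≡false
      failing : ∀ {k} → does (length S ≤? k) ≡ true × enough? i S k ≡ false → failsAt i E (length S) k S ≡ true
      failing (≤k , ¬enough) = cong₂ _∧_ large≡ (cong₂ _∧_ ≤k (cong not ¬enough))

  failsAt-above-≲ : 0ℚ < t → 1 ≤ n → ∀ i E {C j ℓ} d → E ^ suc d * B ≤ C →
    C * badSum i (ℓ + d) j ≲ n ^ (ℓ + d + j) ·p^ ((ℓ + d) * j) →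
    E * sumOf (λ S → cardN G S ^ ℓ) (filter (failsAt i E j (ℓ + d)) (seqs G j)) ≲ n ^ (j + ℓ) ·p^ (j * ℓ)
  failsAt-above-≲ 0<t 1≤n i E {C} {j} {ℓ} d E^[1+d]*B≤C IH =
    lower-moment-≲ 0<t 1≤n E {j} {ℓ} {d} F F-large (≲-monoˡ higher-moment≤ IH)
    where
    k : ℕ
    k = ℓ + d
    F : List (List (Fin n))
    F = filter (failsAt i E j k) (seqs G j)
    in-F : All (λ S → failsAt i E j k S ≡ true × length S ≡ j) F
    in-F = filter-All _ (seqs-length G j)
    failsAt⇒Large : ∀ {S} → failsAt i E j k S ≡ true → Large E j S
    failsAt⇒Large {S} fails = does≡true⇒ (Large? E j S) (proj₁ (∧≡true⇒ {large? E j S} fails))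
    F-large : All (Large E j) F
    F-large = All.map (λ {S} (fails , _) → failsAt⇒Large {S} fails) in-F
    higher-moment≤ : E ^ suc d * sumOf (λ S → cardN G S ^ k) F ≤ C * badSum i k j
    higher-moment≤ = begin
      E ^ suc d * sumOf (λ S → cardN G S ^ k) F
        ≤⟨ ℕₚ.*-monoʳ-≤ (E ^ suc d) (sumOf-mono (All.map (λ {S} (fails , _) → ¬enough⇒≤ i S k (not-enough fails)) in-F)) ⟩
      E ^ suc d * sumOf (λ S → B * countBad i S k) F
        ≡⟨ cong (E ^ suc d *_) (sumOf-*ˡ B (λ S → countBad i S k) F) ⟩
      E ^ suc d * (B * sumOf (λ S → countBad i S k) F)
        ≤⟨ ℕₚ.*-monoʳ-≤ (E ^ suc d) (ℕₚ.*-monoʳ-≤ B (sumOf-filter-≤ (λ S → countBad i S k) _ (seqs G j))) ⟩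
      E ^ suc d * (B * sumOf (λ S → countBad i S k) (seqs G j))
        ≡⟨ cong (λ y → E ^ suc d * (B * y)) (double-counting G (λ T → not (good i T)) j k) ⟩
      E ^ suc d * (B * badSum i k j)
        ≡⟨ ℕₚ.*-assoc (E ^ suc d) B (badSum i k j) ⟨
      E ^ suc d * B * badSum i k j
        ≤⟨ ℕₚ.*-monoˡ-≤ (badSum i k j) E^[1+d]*B≤C ⟩
      C * badSum i k j ∎
      where
      open ℕₚ.≤-Reasoning
      not-enough : ∀ {S} → failsAt i E j k S ≡ true → enough? i S k ≡ false
      not-enough {S} fails =
        not≡true⇒≡false (proj₂ (∧≡true⇒ {does (j ≤? k)} (proj₂ (∧≡true⇒ {large? E j S} fails))))

  failsAt-≲ : 0ℚ < t → 1 ≤ n → ∀ i {E C j ℓ k} → 1 ≤ E → ℓ ≤ j → k ≤ h → B * E ^ suc h ≤ C →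
    (j ≤ k → C * badSum i k j ≲ n ^ (k + j) ·p^ (k * j)) →
    E * sumOf (λ S → cardN G S ^ ℓ) (filter (failsAt i E j k) (seqs G j)) ≲ n ^ (j + ℓ) ·p^ (j * ℓ)
  failsAt-≲ 0<t 1≤n i {E} {C} {j} {ℓ} {k} 1≤E ℓ≤j k≤h B*Eʰ≤C IH with j ≤? k
  ... | no j≰k = subst (_≲ n ^ (j + ℓ) ·p^ (j * ℓ)) (≡.sym (trans (cong (λ F → E * sumOf _ F) no-fails) (ℕₚ.*-zeroʳ E)))
                       (0≲ (n ^ (j + ℓ)) (j * ℓ))
    where
    no-fails : filter (failsAt i E j k) (seqs G j) ≡ []
    no-fails = filter-none _ (seqs G j) (λ S →
      trans (cong (λ b → large? E j S ∧ (b ∧ not (enough? i S k))) (dec-false (j ≤? k) j≰k)) (Boolₚ.∧-zeroʳ (large? E j S)))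
  ... | yes j≤k =
    subst (λ k → E * sumOf (λ S → cardN G S ^ ℓ) (filter (failsAt i E j k) (seqs G j)) ≲ n ^ (j + ℓ) ·p^ (j * ℓ)) ℓ+d≡k
      (failsAt-above-≲ 0<t 1≤n i E {j = j} {ℓ} d E^[1+d]*B≤C
        (subst (λ k → C * badSum i k j ≲ n ^ (k + j) ·p^ (k * j)) (≡.sym ℓ+d≡k) (IH j≤k)))
    where
    d : ℕ
    d = k ∸ ℓ
    ℓ+d≡k : ℓ + d ≡ k
    ℓ+d≡k = ℕₚ.m+[n∸m]≡n (ℕₚ.≤-trans ℓ≤j j≤k)
    E^[1+d]*B≤C : E ^ suc d * B ≤ C
    E^[1+d]*B≤C = ℕₚ.≤-trans
      (ℕₚ.*-monoˡ-≤ B (ℕₚ.^-monoʳ-≤ E {{ℕ.>-nonZero 1≤E}} (s≤s (ℕₚ.≤-trans (ℕₚ.m≤n+m d ℓ) (subst (_≤ h) (≡.sym ℓ+d≡k) k≤h)))))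
      (subst (_≤ C) (ℕₚ.*-comm B (E ^ suc h)) B*Eʰ≤C)

  badSum₀-≲ : ∀ {E j ℓ} → E ≤ A → 1 ≤ ℓ → E * badSum 0 j ℓ ≲ n ^ (j + ℓ) ·p^ (j * ℓ)
  badSum₀-≲ {E} {j} E≤A 1≤ℓ = ≲-monoˡ (ℕₚ.*-monoˡ-≤ _ E≤A) (sumOf-small-≲ A {j} 1≤ℓ _ small)
    where
    small : ∀ S → length S ≡ j → not (good0 S) ≡ true → ¬ Large A j S
    small S |S|≡j bad = subst (λ l → ¬ Large A l S) |S|≡j (¬good0⇒¬Large S (not≡true⇒≡false bad))

  step : 0ℚ < t → 1 ≤ n → ∀ i {Cs Ci} → 1 ≤ Cs → (3 + h) * Cs ≤ A → B * ((3 + h) * Cs) ^ suc h ≤ Ci →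
    (∀ {k ℓ} → 1 ≤ k → k ≤ h → 1 ≤ ℓ → ℓ ≤ k → Ci * badSum i k ℓ ≲ n ^ (k + ℓ) ·p^ (k * ℓ)) →
    ∀ {j ℓ} → 1 ≤ j → j ≤ h → 1 ≤ ℓ → ℓ ≤ j → Cs * badSum (suc i) j ℓ ≲ n ^ (j + ℓ) ·p^ (j * ℓ)
  step 0<t 1≤n i {Cs} {Ci} 1≤Cs E≤A B*Eʰ≤Ci IH {j} {ℓ} 1≤j j≤h 1≤ℓ ℓ≤j =
    ≲-cancel (3 + h) (s≤s z≤n) (≲-monoˡ covered (≲-monoʳ (ℕₚ.≤-reflexive #pieces) (≲-sum _ _ piece-bounds)))
    where
    E : ℕ
    E = (3 + h) * Cs
    1≤E : 1 ≤ E
    1≤E = ℕₚ.*-mono-≤ {1} {3 + h} (s≤s z≤n) 1≤Cs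
    piece : (List (Fin n) → Bool) → ℕ
    piece q = sumOf (λ S → cardN G S ^ ℓ) (filter q (seqs G j))
    covered : (3 + h) * (Cs * badSum (suc i) j ℓ) ≤ sumOf (λ q → E * piece q) (pieces i E j)
    covered = begin
      (3 + h) * (Cs * badSum (suc i) j ℓ)  ≡⟨ ℕₚ.*-assoc (3 + h) Cs _ ⟨
      E * badSum (suc i) j ℓ              ≤⟨ ℕₚ.*-monoʳ-≤ E (sumOf-filter-cover _ _ (pieces i E j) (seqs G j)
                                              (All.map (bad-covered i E j≤h _) (seqs-length G j))) ⟩
      E * sumOf piece (pieces i E j)      ≡⟨ sumOf-*ˡ E piece (pieces i E j) ⟨
      sumOf (λ q → E * piece q) (pieces i E j) ∎
      where open ℕₚ.≤-Reasoning
    #pieces : sumOf (λ _ → n ^ (j + ℓ)) (pieces i E j) ≡ (3 + h) * n ^ (j + ℓ)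
    #pieces = trans (sumOf-const (n ^ (j + ℓ)) (pieces i E j)) (cong (_* n ^ (j + ℓ)) (length-pieces i E j))
    piece-bounds : All (λ q → E * piece q ≲ n ^ (j + ℓ) ·p^ (j * ℓ)) (pieces i E j)
    piece-bounds = badSum₀-≲ {E} {j} E≤A 1≤ℓ
      ∷ sumOf-small-≲ E {j} 1≤ℓ _ (λ S _ small → does≡false⇒¬ (Large? E j S) (not≡true⇒≡false small))
      ∷ Allₚ.map⁺ (All.map (λ k≤h → failsAt-≲ 0<t 1≤n i 1≤E ℓ≤j k≤h B*Eʰ≤Ci (λ j≤k → IH (ℕₚ.≤-trans 1≤j j≤k) k≤h 1≤j j≤k))
                           (range-≤ h))

-- The constants

weight : ℕ → ℕ → ℕ → ℕ
weight B h zero    = B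
weight B h (suc s) = B * ((3 + h) * weight B h s) ^ suc h

module WeightProperties {B : ℕ} (h : ℕ) (1≤B : 1 ≤ B) where

  1≤weight : ∀ s → 1 ≤ weight B h s
  1≤weight zero    = 1≤B
  1≤weight (suc s) = ℕₚ.*-mono-≤ {1} {B} 1≤B
    (subst (_≤ ((3 + h) * weight B h s) ^ suc h) (ℕₚ.^-zeroˡ (suc h))
           (ℕₚ.^-monoˡ-≤ (suc h) (ℕₚ.*-mono-≤ {1} {3 + h} (s≤s z≤n) (1≤weight s))))

  weight-≤-suc : ∀ s → weight B h s ≤ weight B h (suc s)
  weight-≤-suc s = begin
    weight B h s                           ≤⟨ ℕₚ.m≤n*m (weight B h s) (3 + h) ⟩
    (3 + h) * weight B h s                 ≤⟨ ≤-^ ((3 + h) * weight B h s) (suc h) (s≤s z≤n) ⟩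
    ((3 + h) * weight B h s) ^ suc h       ≤⟨ ℕₚ.m≤n*m _ B {{ℕ.>-nonZero 1≤B}} ⟩
    weight B h (suc s)                     ∎
    where open ℕₚ.≤-Reasoning

  weight-mono : ∀ {s s′} → s ≤ s′ → weight B h s ≤ weight B h s′
  weight-mono {zero}  {zero}    _         = ℕₚ.≤-refl
  weight-mono {zero}  {suc s′}  _         = ℕₚ.≤-trans (weight-mono {zero} {s′} z≤n) (weight-≤-suc s′)
  weight-mono {suc s} {suc s′} (s≤s s≤s′) =
    ℕₚ.*-monoʳ-≤ B (ℕₚ.^-monoˡ-≤ (suc h) (ℕₚ.*-monoʳ-≤ (3 + h) (weight-mono s≤s′)))

module BadSumBound (h : ℕ) {β : ℚ} (0<β : 0ℚ < β) where

  ↧β : ℕ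
  ↧β = ℚ.denominatorℕ β

  open WeightProperties {↧β} h (s≤s z≤n)

  α⁻¹ : ℕ
  α⁻¹ = (3 + h) * weight ↧β h h

  0<α⁻¹ : 0ℚ < ℕ→ℚ α⁻¹
  0<α⁻¹ = ℕ→ℚ-pos (ℕₚ.*-mono-≤ {1} {3 + h} (s≤s z≤n) (1≤weight h))

  instance
    α⁻¹≢0 : ℚ.NonZero (ℕ→ℚ α⁻¹)
    α⁻¹≢0 = ℚₚ.pos⇒nonZero (ℕ→ℚ α⁻¹) {{ℚ.positive 0<α⁻¹}}

  α : ℚ
  α = ℚ.1/ ℕ→ℚ α⁻¹

  0<α : 0ℚ < α
  0<α = ℚₚ.positive⁻¹ α {{ℚₚ.1/pos⇒pos (ℕ→ℚ α⁻¹) {{ℚ.positive 0<α⁻¹}}}}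

  module _ {n : ℕ} (G : Graph n) (r′ : ℕ) where
    open Density G r′
    open GoodnessBounds G r′ {α} {β} h α⁻¹ (ℚₚ.<⇒≤ 0<α) (ℚₚ.*-inverseˡ (ℕ→ℚ α⁻¹)) ↧β (1≤β*denominator 0<β)
    open Goodness G α β h r using (badSum)

    weighted-bound : 0ℚ < t → ∀ i s → i + s ≤ h → ∀ {j ℓ} → 1 ≤ j → j ≤ h → 1 ≤ ℓ → ℓ ≤ j →
      weight ↧β h s * badSum i j ℓ ≲ n ^ (j + ℓ) ·p^ (j * ℓ)
    weighted-bound 0<t zero    s s≤h {j} _ _ 1≤ℓ _ =
      badSum₀-≲ {j = j} (ℕₚ.≤-trans (weight-mono s≤h) (ℕₚ.m≤n*m (weight ↧β h h) (3 + h))) 1≤ℓ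
    weighted-bound 0<t (suc i) s 1+i+s≤h =
      step 0<t (tStar-pos⇒1≤n G r 0<t) i (1≤weight s)
        (ℕₚ.*-monoʳ-≤ (3 + h) (weight-mono (ℕₚ.≤-trans (ℕₚ.m≤n+m s (suc i)) 1+i+s≤h)))
        ℕₚ.≤-refl
        (weighted-bound 0<t i (suc s) (subst (_≤ h) (≡.sym (ℕₚ.+-suc i s)) 1+i+s≤h))

    badSum-bound : ∀ i j ℓ → i ≤ h → 1 ≤ j → j ≤ h → 1 ≤ ℓ → ℓ ≤ j →
      ≤c·p^ G r (ℕ→ℚ (badSum i j ℓ)) (β *ℚ ℕ→ℚ (n ^ (j + ℓ))) (j * ℓ)
    badSum-bound i (suc j) (suc ℓ) i≤h 1≤j j≤h 1≤ℓ ℓ≤j = [ edgeless , dense ]′ t≡0⊎0<t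
      where
      Goal : ℕ → Set
      Goal X = ≤c·p^ G r (ℕ→ℚ X) (β *ℚ ℕ→ℚ (n ^ (suc j + suc ℓ))) (suc j * suc ℓ)
      edgeless : t ≡ 0ℚ → Goal (badSum i (suc j) (suc ℓ))
      edgeless t≡0 = subst Goal (≡.sym (badSum≡0 G r′ t≡0 α β h i j ℓ))
        (0≤c·p^ (suc j * suc ℓ) (*ℚ-nonNeg (ℚₚ.<⇒≤ 0<β) (ℕ→ℚ-nonNeg (n ^ (suc j + suc ℓ)))))
      dense : 0ℚ < t → Goal (badSum i (suc j) (suc ℓ))
      dense 0<t = ≲⇒≤c·p^ {β} {↧β} {badSum i (suc j) (suc ℓ)} {n ^ (suc j + suc ℓ)} {suc j * suc ℓ}
        (ℚₚ.<⇒≤ 0<β) (1≤β*denominator 0<β)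
        (weighted-bound 0<t i 0 (subst (_≤ h) (≡.sym (ℕₚ.+-identityʳ i)) i≤h) 1≤j j≤h 1≤ℓ ℓ≤j)

lemma3p4 : (h r : ℕ) → 1 ≤ r → r ≤ h → (β : ℚ) → 0ℚ < β → β < 1ℚ →
    Σ ℚ (λ α → (0ℚ < α) ×
      ((n : ℕ) (G : Graph n) (i j ℓ : ℕ) → i ≤ h → 1 ≤ j → j ≤ h → 1 ≤ ℓ → ℓ ≤ j →
        ≤c·p^ G r (ℕ→ℚ (Goodness.badSum G α β h r i j ℓ))
          (β *ℚ ℕ→ℚ (n ^ (j + ℓ))) (j * ℓ)))
lemma3p4 h (suc r′) _ _ β 0<β _ = α , 0<α , λ n G → badSum-bound G r′
  where open BadSumBound h 0<β
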